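{- Let $n\ge 5$ be an integer. If $n$ is prime then $\operatorname{aw}(\mathbb{Z}_n,n-2)=n-2$; otherwise $\operatorname{aw}(\mathbb{Z}_n,n-2)=n-1$.
   Context: $\mathbb{Z}_n$ is the cyclic group of integers mod $n$. A $k$-AP in $\mathbb{Z}_n$ is a set of $k$ distinct elements $a,a+d,\dots,a+(k-1)d$ (mod $n$), $d\not\equiv 0$. An $r$-coloring is a map $\mathbb{Z}_n\to\{1,\dots,r\}$, exact if surjective; a $k$-AP is rainbow if its elements receive $k$ distinct colors. $\operatorname{aw}(\mathbb{Z}_n,k)$ is the smallest $r$ such that every exact $r$-coloring of $\mathbb{Z}_n$ contains a rainbow $k$-AP. -}

module Defs where

open import Data.Nat using (ℕ; zero; suc; _+_; _*_; _≤_; _<_; NonZero)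
open import Data.Nat.DivMod using (_%_; m%n<n)
open import Data.Fin using (Fin; toℕ; fromℕ<)
open import Data.Product using (Σ; _×_)
open import Function.Definitions using (Injective; Surjective)
open import Relation.Binary.PropositionalEquality using (_≡_)
open import Relation.Nullary using (¬_)

toZ : (n : ℕ) → .{{_ : NonZero n}} → ℕ → Fin n
toZ n m = fromℕ< (m%n<n m n)

apTerm : (n : ℕ) → .{{_ : NonZero n}} → Fin n → Fin n → ℕ → Fin n
apTerm n a d i = toZ n (toℕ a + i * toℕ d)

apSeq : (n : ℕ) → .{{_ : NonZero n}} → (k : ℕ) → Fin n → Fin n → Fin k → Fin n
apSeq n k a d i = apTerm n a d (toℕ i)

IsKAP : (n : ℕ) → .{{_ : NonZero n}} → (k : ℕ) → Fin n → Fin n → Set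
IsKAP n k a d = ¬ (toℕ d ≡ 0) × Injective _≡_ _≡_ (apSeq n k a d)

HasRainbowAP : (n : ℕ) → .{{_ : NonZero n}} → (k : ℕ) → {r : ℕ} → (Fin n → Fin r) → Set
HasRainbowAP n k c =
  Σ (Fin n) λ a → Σ (Fin n) λ d →
    IsKAP n k a d × Injective _≡_ _≡_ (λ i → c (apSeq n k a d i))

EveryExactColoringRainbow : (n : ℕ) → .{{_ : NonZero n}} → (k r : ℕ) → Set
EveryExactColoringRainbow n k r =
  (c : Fin n → Fin r) → Surjective _≡_ _≡_ c → HasRainbowAP n k c

-- aw(ℤ_n, k) = r : r is the smallest positive number of colors such that
-- every exact r-coloring of ℤ_n contains a rainbow k-AP.
AWEq : (n : ℕ) → .{{_ : NonZero n}} → (k r : ℕ) → Set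
AWEq n k r =
  1 ≤ r × EveryExactColoringRainbow n k r
    × ((s : ℕ) → 1 ≤ s → s < r → ¬ EveryExactColoringRainbow n k s)

-- Fix a representative of every colour of an exact r-colouring c;
-- the other points are "surplus".  Surplus points and representatives are disjoint,
-- so there are at most n - r surplus points, and c is injective on the rest.  If all
-- surplus points lie in {x, x+d} for a difference d of full additive order, the cycle
-- x, x+d, …, x+(n-1)d runs through all of ℤ_n, and its last n-2 terms form a rainbow
-- AP.  With n-1 colours one surplus point x is all there is (take d = 1); with n-2
-- colours there are at most two, x and y, and d = y - x has full order when n is prime.
--
-- Colouring by residues mod s < n-2 gives s colours but no rainbow
-- (n-2)-AP.  For composite n pick a proper divisor e with 2e < n and give 0, e, 2e one
-- colour (n-2 colours in total).  A rainbow (n-2)-AP has difference of full order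
-- (otherwise it repeats after a proper divisor of n ≤ n/2 < n-2 steps), so it misses
-- exactly two consecutive points of its cycle; two of 0, e, 2e are missed, hence e
-- divides the difference d, contradicting full order.
module Submission where

open import Defs
open import Data.Nat using (ℕ; _≤_; _∸_; NonZero)
open import Data.Nat.Primality using (Prime)
open import Data.Product using (_×_)
open import Relation.Nullary using (¬_)

open import Data.Empty using (⊥; ⊥-elim)
open import Data.Fin as Fin using (Fin; toℕ; fromℕ<; splitAt; join; punchIn; punchOut)
open import Data.Fin.Properties
  using (toℕ-injective; toℕ-fromℕ<; toℕ<n; any?; injective⇒≤; join-splitAt;
         punchOut-injective; punchOut-cong; punchOut-punchIn; punchInᵢ≢i)
open import Data.Nat using (zero; suc; _+_; _*_; _<_; z≤n; s≤s; z<s; _<?_; s<s; s≤s⁻¹; nonTrivial⇒n>1; >-nonZero; >-nonZero⁻¹)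
open import Data.Nat.Properties
open import Data.Nat.DivMod using (_%_; _/_; m≡m%n+[m/n]*n; [m+kn]%n≡m%n; m<n⇒m%n≡m; %-distribˡ-+; m%n%n≡m%n)
open import Data.Nat.Divisibility
open import Data.Nat.GCD using (gcd; gcd[m,n]∣m; gcd[m,n]∣n; gcd[m,n]≢0; gcd-greatest; c*gcd[m,n]≡gcd[cm,cn])
open import Data.Nat.Primality using (euclidsLemma; ¬prime⇒composite; composite)
open import Data.Product using (Σ-syntax; ∃; ∃-syntax; _,_; proj₁; proj₂)
open import Data.Sum using (_⊎_; inj₁; inj₂; [_,_]′)
open import Data.Vec using (Vec; []; _∷_)
open import Data.Vec.Relation.Unary.All using (All; []; _∷_)
open import Data.Vec.Relation.Unary.All.Properties using (lookup⁺)
open import Data.Vec.Relation.Unary.AllPairs using ([]; _∷_)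
open import Data.Vec.Relation.Unary.Unique.Propositional using (Unique)
open import Data.Vec.Relation.Unary.Unique.Propositional.Properties using (lookup-injective)
open import Function using (_∘_)
open import Function.Definitions using (Injective; Surjective)
open import Relation.Binary.Definitions using (tri<; tri≈; tri>)
open import Relation.Binary.PropositionalEquality
open import Relation.Nullary using (Dec; yes; no)
open import Relation.Nullary.Decidable using (¬?; _×-dec_; decidable-stable)

disjoint-injections⇒≤ : ∀ {r k n} {g : Fin r → Fin n} {b : Fin k → Fin n} →
  Injective _≡_ _≡_ g → Injective _≡_ _≡_ b → (∀ i j → g i ≢ b j) → r + k ≤ n
disjoint-injections⇒≤ {r} {k} {g = g} {b} g-inj b-inj disjoint =
  injective⇒≤ {f = [ g , b ]′ ∘ splitAt r} (splitAt-injective ∘ copair-injective)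
  where
  copair-injective : Injective _≡_ _≡_ [ g , b ]′
  copair-injective {inj₁ i} {inj₁ j} e = cong inj₁ (g-inj e)
  copair-injective {inj₁ i} {inj₂ j} e = ⊥-elim (disjoint i j e)
  copair-injective {inj₂ i} {inj₁ j} e = ⊥-elim (disjoint j i (sym e))
  copair-injective {inj₂ i} {inj₂ j} e = cong inj₂ (b-inj e)

  splitAt-injective : Injective _≡_ _≡_ (splitAt r {k})
  splitAt-injective {i} {j} e =
    trans (sym (join-splitAt r k i)) (trans (cong (join r k) e) (join-splitAt r k j))

excess-absurd : ∀ {n r k} → n ≤ r + k → r + suc k ≤ n → ⊥
excess-absurd {n} {r} {k} n≤r+k r+k+1≤n =
  1+n≰n (≤-trans (subst (_≤ n) (+-suc r k) r+k+1≤n) n≤r+k)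

InjectiveAway : ∀ {n r} → (Fin n → Fin r) → Fin n → Fin n → Set
InjectiveAway c p q = ∀ {z w} → z ≢ p → z ≢ q → w ≢ p → w ≢ q → c z ≡ c w → z ≡ w

away-sym : ∀ {n r} {c : Fin n → Fin r} {p q} → InjectiveAway c p q → InjectiveAway c q p
away-sym away z≢q z≢p w≢q w≢p = away z≢p z≢q w≢p w≢q

away-one : ∀ {n r} {c : Fin n → Fin r} {p p′ q} → p′ ≡ p → InjectiveAway c p p → InjectiveAway c p′ q
away-one refl away z≢p _ w≢p _ = away z≢p z≢p w≢p w≢p

module Surplus {n r : ℕ} (c : Fin n → Fin r) (exact : Surjective _≡_ _≡_ c) where

  rep : Fin r → Fin n
  rep y = proj₁ (exact y)

  c∘rep : ∀ y → c (rep y) ≡ y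
  c∘rep y = proj₂ (exact y) refl

  rep-injective : Injective _≡_ _≡_ rep
  rep-injective {y} {y′} e = trans (sym (c∘rep y)) (trans (cong c e) (c∘rep y′))

  IsSurplus : Fin n → Set
  IsSurplus z = rep (c z) ≢ z

  surplus? : ∀ z → Dec (IsSurplus z)
  surplus? z = ¬? (rep (c z) Fin.≟ z)

  surplus-not-rep : ∀ {z} → IsSurplus z → ∀ y → rep y ≢ z
  surplus-not-rep {z} surplus y rep-y≡z =
    surplus (trans (cong (rep ∘ c) (sym rep-y≡z)) (trans (cong rep (c∘rep y)) rep-y≡z))

  surplus-bound : ∀ {k} (zs : Vec (Fin n) k) → Unique zs → All IsSurplus zs → r + k ≤ n
  surplus-bound zs distinct surplus =
    disjoint-injections⇒≤ rep-injective (λ {i} {j} → lookup-injective distinct i j)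
      (λ y i → surplus-not-rep (lookup⁺ surplus i) y)

  covered⇒away : ∀ {p q} → (∀ z → IsSurplus z → z ≡ p ⊎ z ≡ q) → InjectiveAway c p q
  covered⇒away {p} {q} cover z≢p z≢q w≢p w≢q cz≡cw =
    trans (sym (is-rep z≢p z≢q)) (trans (cong rep cz≡cw) (is-rep w≢p w≢q))
    where
    is-rep : ∀ {z} → z ≢ p → z ≢ q → rep (c z) ≡ z
    is-rep {z} z≢p z≢q =
      decidable-stable (rep (c z) Fin.≟ z) λ surplus → [ z≢p , z≢q ]′ (cover z surplus)

  SurplusCases : Set
  SurplusCases = (Σ[ p ∈ Fin n ] InjectiveAway c p p) ⊎
                 (Σ[ p ∈ Fin n ] Σ[ q ∈ Fin n ] p ≢ q × IsSurplus p × IsSurplus q)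

  surplus-cases : Fin n → SurplusCases
  surplus-cases z₀ with any? surplus?
  ... | no none = inj₁ (z₀ , covered⇒away λ z surplus → ⊥-elim (none (z , surplus)))
  ... | yes (p , sp) with any? (λ q → surplus? q ×-dec ¬? (q Fin.≟ p))
  ...   | no only-p = inj₁ (p , covered⇒away λ z surplus →
                        inj₁ (decidable-stable (z Fin.≟ p) λ z≢p → only-p (z , surplus , z≢p)))
  ...   | yes (q , sq , q≢p) = inj₂ (p , q , ≢-sym q≢p , sp , sq)

  no-two-surplus : n ≤ r + 1 → ∀ {p q} → p ≢ q → IsSurplus p → IsSurplus q → ⊥
  no-two-surplus n≤r+1 p≢q sp sq =
    excess-absurd n≤r+1 (surplus-bound (_ ∷ _ ∷ []) ((p≢q ∷ []) ∷ [] ∷ []) (sp ∷ sq ∷ []))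

  two-surplus-away : n ≤ r + 2 → ∀ {p q} → p ≢ q → IsSurplus p → IsSurplus q →
    InjectiveAway c p q
  two-surplus-away n≤r+2 {p} {q} p≢q sp sq = covered⇒away cover
    where
    cover : ∀ z → IsSurplus z → z ≡ p ⊎ z ≡ q
    cover z sz with z Fin.≟ p | z Fin.≟ q
    ... | yes z≡p | _ = inj₁ z≡p
    ... | no _ | yes z≡q = inj₂ z≡q
    ... | no z≢p | no z≢q = ⊥-elim (excess-absurd n≤r+2 (surplus-bound (z ∷ p ∷ q ∷ [])
          ((z≢p ∷ z≢q ∷ []) ∷ (p≢q ∷ []) ∷ [] ∷ []) (sz ∷ sp ∷ sq ∷ [])))

+-cancel-mod : ∀ {n} .{{_ : NonZero n}} A B → (A + B) % n ≡ A % n → n ∣ B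
+-cancel-mod {n} A B same-residue = divides ((A + B) / n ∸ A / n) (begin
   B                                               ≡⟨ m+n∸m≡n A B ⟨
   A + B ∸ A                                       ≡⟨ cong₂ _∸_ A+B≡ (m≡m%n+[m/n]*n A n) ⟩
   (A % n + (A + B) / n * n) ∸ (A % n + A / n * n) ≡⟨ [m+n]∸[m+o]≡n∸o (A % n) _ _ ⟩
   (A + B) / n * n ∸ A / n * n                     ≡⟨ *-distribʳ-∸ n ((A + B) / n) (A / n) ⟨
   ((A + B) / n ∸ A / n) * n                       ∎)
  where
  open ≡-Reasoning
  A+B≡ : A + B ≡ A % n + (A + B) / n * n
  A+B≡ = trans (m≡m%n+[m/n]*n (A + B) n) (cong (_+ (A + B) / n * n) same-residue)

%-absorbˡ : ∀ {n} .{{_ : NonZero n}} A B → (A % n + B) % n ≡ (A + B) % n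
%-absorbˡ {n} A B = begin
  (A % n + B) % n         ≡⟨ %-distribˡ-+ (A % n) B n ⟩
  (A % n % n + B % n) % n ≡⟨ cong (λ a → (a + B % n) % n) (m%n%n≡m%n A n) ⟩
  (A % n + B % n) % n     ≡⟨ %-distribˡ-+ A B n ⟨
  (A + B) % n             ∎
  where open ≡-Reasoning

-- D has full additive order in ℤ_n: no multiple w·D with 0 < w < n vanishes
-- (equivalently gcd(D, n) = 1).
FullOrder : ℕ → ℕ → Set
FullOrder n D = ∀ w → 0 < w → w < n → ¬ (n ∣ w * D)

fullOrder-one : ∀ n → FullOrder n 1
fullOrder-one n w 0<w w<n n∣w*1 =
  <⇒≱ w<n (∣⇒≤ {{>-nonZero 0<w}} (subst (n ∣_) (*-identityʳ w) n∣w*1))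

fullOrder-prime : ∀ {n D} → Prime n → 0 < D → D < n → FullOrder n D
fullOrder-prime {D = D} n-prime 0<D D<n w 0<w w<n n∣w*D
  with euclidsLemma w D n-prime n∣w*D
... | inj₁ n∣w = <⇒≱ w<n (∣⇒≤ {{>-nonZero 0<w}} n∣w)
... | inj₂ n∣D = <⇒≱ D<n (∣⇒≤ {{>-nonZero 0<D}} n∣D)

fullOrder⇒≢0 : ∀ {n D} → 1 < n → FullOrder n D → D ≢ 0
fullOrder⇒≢0 {n} 1<n full refl = full 1 z<s 1<n (n ∣0)

-- A proper divisor e of n never divides a difference of full order: n/e steps vanish.
fullOrder⇒∤ : ∀ {n D e} .{{_ : NonZero n}} → FullOrder n D → e ∣ n → 1 < e → ¬ (e ∣ D)
fullOrder⇒∤ {n} {D} {e} full e∣n 1<e e∣D =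
  full q 0<q q<n (subst (_∣ q * D) (sym n≡q*e) (*-monoʳ-∣ q e∣D))
  where
  q : ℕ
  q = quotient e∣n
  n≡q*e : n ≡ q * e
  n≡q*e = m∣n⇒n≡quotient*m e∣n
  0<q : 0 < q
  0<q = >-nonZero⁻¹ q {{quotient≢0 e∣n}}
  q<n : q < n
  q<n = subst (q <_) (sym n≡q*e) (m<m*n q e {{quotient≢0 e∣n}} 1<e)

module _ {n : ℕ} .{{_ : NonZero n}} {x d : Fin n} where

  toℕ-apTerm : ∀ i → toℕ (apTerm n x d i) ≡ (toℕ x + i * toℕ d) % n
  toℕ-apTerm i = toℕ-fromℕ< _

  apTerm-zero : apTerm n x d 0 ≡ x
  apTerm-zero = toℕ-injective (begin
    toℕ (apTerm n x d 0)   ≡⟨ toℕ-apTerm 0 ⟩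
    (toℕ x + 0) % n         ≡⟨ cong (_% n) (+-identityʳ (toℕ x)) ⟩
    toℕ x % n               ≡⟨ m<n⇒m%n≡m (toℕ<n x) ⟩
    toℕ x                   ∎)
    where open ≡-Reasoning

  term-split : ∀ u w → toℕ x + (u + w) * toℕ d ≡ toℕ x + u * toℕ d + w * toℕ d
  term-split u w = trans (cong (toℕ x +_) (*-distribʳ-+ (toℕ d) u w)) (sym (+-assoc (toℕ x) _ _))

  apTerm-shift : ∀ s i → apTerm n (apTerm n x d s) d i ≡ apTerm n x d (s + i)
  apTerm-shift s i = toℕ-injective (begin
    toℕ (apTerm n (apTerm n x d s) d i)          ≡⟨ toℕ-fromℕ< _ ⟩
    (toℕ (apTerm n x d s) + i * toℕ d) % n       ≡⟨ cong (λ a → (a + i * toℕ d) % n) (toℕ-apTerm s) ⟩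
    ((toℕ x + s * toℕ d) % n + i * toℕ d) % n    ≡⟨ %-absorbˡ (toℕ x + s * toℕ d) (i * toℕ d) ⟩
    (toℕ x + s * toℕ d + i * toℕ d) % n          ≡⟨ cong (_% n) (term-split s i) ⟨
    (toℕ x + (s + i) * toℕ d) % n                ≡⟨ toℕ-apTerm (s + i) ⟨
    toℕ (apTerm n x d (s + i))                   ∎)
    where open ≡-Reasoning

  apTerm-period : ∀ {g} → n ∣ g * toℕ d → apTerm n x d g ≡ apTerm n x d 0
  apTerm-period {g} (divides q g*d≡q*n) = toℕ-injective (begin
    toℕ (apTerm n x d g)         ≡⟨ toℕ-apTerm g ⟩
    (toℕ x + g * toℕ d) % n      ≡⟨ cong (λ t → (toℕ x + t) % n) g*d≡q*n ⟩
    (toℕ x + q * n) % n          ≡⟨ [m+kn]%n≡m%n (toℕ x) q n ⟩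
    toℕ x % n                    ≡⟨ cong (_% n) (+-identityʳ (toℕ x)) ⟨
    (toℕ x + 0 * toℕ d) % n      ≡⟨ toℕ-apTerm 0 ⟨
    toℕ (apTerm n x d 0)         ∎)
    where open ≡-Reasoning

  module _ (full : FullOrder n (toℕ d)) where

    -- With a difference of full order the n terms x, x+d, …, x+(n-1)d are distinct:
    -- equal terms u ≤ u + w force n ∣ w·d, hence w = 0.
    apTerm-injective-≤ : ∀ {u v} → u ≤ v → v < n → apTerm n x d u ≡ apTerm n x d v → u ≡ v
    apTerm-injective-≤ {u} u≤v v<n same with m≤n⇒∃[o]m+o≡n u≤v
    ... | zero , refl = sym (+-identityʳ u)
    ... | suc w , refl = ⊥-elim (full (suc w) z<s (≤-<-trans (m≤n+m (suc w) u) v<n)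
      (+-cancel-mod (toℕ x + u * toℕ d) (suc w * toℕ d) (begin
        (toℕ x + u * toℕ d + suc w * toℕ d) % n ≡⟨ cong (_% n) (term-split u (suc w)) ⟨
        (toℕ x + (u + suc w) * toℕ d) % n       ≡⟨ toℕ-apTerm (u + suc w) ⟨
        toℕ (apTerm n x d (u + suc w))          ≡⟨ cong toℕ same ⟨
        toℕ (apTerm n x d u)                    ≡⟨ toℕ-apTerm u ⟩
        (toℕ x + u * toℕ d) % n                 ∎)))
      where open ≡-Reasoning

    apTerm-injective : ∀ {u v} → u < n → v < n → apTerm n x d u ≡ apTerm n x d v → u ≡ v
    apTerm-injective {u} {v} u<n v<n same with ≤-total u v
    ... | inj₁ u≤v = apTerm-injective-≤ u≤v v<n same
    ... | inj₂ v≤u = sym (apTerm-injective-≤ v≤u u<n (sym same))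

    apTerm-surjective : ∀ z → ∃[ j ] j < n × apTerm n x d j ≡ z
    apTerm-surjective z with any? (λ (j : Fin n) → apTerm n x d (toℕ j) Fin.≟ z)
    ... | yes (j , hit) = toℕ j , toℕ<n j , hit
    ... | no missed = ⊥-elim (m+1+n≰m n (disjoint-injections⇒≤ {k = 1}
          (λ {i} {j} same → toℕ-injective (apTerm-injective (toℕ<n i) (toℕ<n j) same))
          (λ { {Fin.zero} {Fin.zero} _ → refl })
          (λ j _ hit → missed (j , hit))))

    missed-tail : ∀ {k} z → (∀ i → apSeq n k x d i ≢ z) → ∃[ j ] k ≤ j × j < n × apTerm n x d j ≡ z
    missed-tail {k} z missed with apTerm-surjective z
    ... | j , j<n , hit with j <? k
    ...   | yes j<k = ⊥-elim (missed (fromℕ< j<k) (trans (cong (apTerm n x d) (toℕ-fromℕ< j<k)) hit))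
    ...   | no j≮k = j , ≮⇒≥ j≮k , j<n , hit

proper-divisor-double : ∀ {g n} → g ∣ n → g < n → g + g ≤ n
proper-divisor-double {g} {n} g∣n g<n = begin
  g + g                  ≡⟨ cong (g +_) (+-identityʳ g) ⟨
  2 * g                  ≤⟨ *-monoˡ-≤ g (quotient>1 g∣n g<n) ⟩
  quotient g∣n * g       ≡⟨ m∣n⇒n≡quotient*m g∣n ⟨
  n                      ∎
  where open ≤-Reasoning

vanishing-divisor : ∀ {n w D} → n ∣ w * D → 0 < w → w < n →
  ∃[ g ] 0 < g × g + g ≤ n × n ∣ g * D
vanishing-divisor {n} {w} {D} n∣w*D 0<w w<n =
  g , n≢0⇒n>0 g≢0 , proper-divisor-double (gcd[m,n]∣n w n) g<n , n∣g*D
  where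
  g : ℕ
  g = gcd w n
  g≢0 : g ≢ 0
  g≢0 = gcd[m,n]≢0 w n (inj₁ (≢-sym (<⇒≢ 0<w)))
  g<n : g < n
  g<n = ≤-<-trans (∣⇒≤ {{>-nonZero 0<w}} (gcd[m,n]∣m w n)) w<n
  n∣g*D : n ∣ g * D
  n∣g*D = subst (n ∣_) (trans (sym (c*gcd[m,n]≡gcd[cm,cn] D w n)) (*-comm D g))
            (gcd-greatest (subst (n ∣_) (*-comm w D) n∣w*D) (n∣m*n D))

-- An injective k-term AP in ℤ_n with n < 2k has a difference of full order: otherwise
-- it would return to its start after g ≤ n/2 < k steps.
injectiveAP⇒fullOrder : ∀ {n k} .{{_ : NonZero n}} {x d : Fin n} → n < k + k →
  Injective _≡_ _≡_ (apSeq n k x d) → FullOrder n (toℕ d)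
injectiveAP⇒fullOrder {n} {k} {x} {d} n<2k injective w 0<w w<n n∣w*D
  with vanishing-divisor n∣w*D 0<w w<n
... | g , 0<g , 2g≤n , n∣g*D = <⇒≢ 0<g (sym g≡0)
  where
  g<k : g < k
  g<k = ≰⇒> λ k≤g → <⇒≱ n<2k (≤-trans (+-mono-≤ k≤g k≤g) 2g≤n)
  0<k : 0 < k
  0<k = ≤-<-trans z≤n g<k
  g≡0 : g ≡ 0
  g≡0 = begin
    g                         ≡⟨ toℕ-fromℕ< g<k ⟨
    toℕ (fromℕ< g<k)          ≡⟨ cong toℕ (injective (begin
      apTerm n x d (toℕ (fromℕ< g<k)) ≡⟨ cong (apTerm n x d) (toℕ-fromℕ< g<k) ⟩
      apTerm n x d g                  ≡⟨ apTerm-period {x = x} {d} {g} n∣g*D ⟩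
      apTerm n x d 0                  ≡⟨ cong (apTerm n x d) (toℕ-fromℕ< 0<k) ⟨
      apTerm n x d (toℕ (fromℕ< 0<k)) ∎)) ⟩
    toℕ (fromℕ< 0<k)          ≡⟨ toℕ-fromℕ< 0<k ⟩
    0                         ∎
    where open ≡-Reasoning

consecutive-multiples : ∀ {n e} .{{_ : NonZero n}} {x d : Fin n} {j} → e ∣ n →
  e ∣ toℕ (apTerm n x d j) → e ∣ toℕ (apTerm n x d (suc j)) → e ∣ toℕ d
consecutive-multiples {n} {e} {x} {d} {j} e∣n e∣j e∣j+1 =
  ∣m+n∣m⇒∣n (subst (e ∣_) shift (divides-term (suc j) e∣j+1)) (divides-term j e∣j)
  where
  divides-term : ∀ i → e ∣ toℕ (apTerm n x d i) → e ∣ toℕ x + i * toℕ d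
  divides-term i e∣i = ∣n∣m%n⇒∣m e∣n (subst (e ∣_) (toℕ-apTerm i) e∣i)
  shift : toℕ x + suc j * toℕ d ≡ toℕ x + j * toℕ d + toℕ d
  shift = trans (cong (toℕ x +_) (+-comm (toℕ d) (j * toℕ d)))
                (sym (+-assoc (toℕ x) (j * toℕ d) (toℕ d)))

rainbow-away : ∀ {n r} .{{_ : NonZero n}} {c : Fin n → Fin r} {x d : Fin n} → 2 ≤ n →
  FullOrder n (toℕ d) → InjectiveAway c (apTerm n x d 0) (apTerm n x d 1) →
  HasRainbowAP n (n ∸ 2) c
rainbow-away {n} {x = x} {d} 2≤n full away =
  apTerm n x d 2 , d , (fullOrder⇒≢0 2≤n full , t-injective) ,
  λ {i} {j} same → t-injective
    (away (avoids i 0 z<s) (avoids i 1 (s<s z<s)) (avoids j 0 z<s) (avoids j 1 (s<s z<s)) same)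
  where
  t : Fin (n ∸ 2) → Fin n
  t = apSeq n (n ∸ 2) (apTerm n x d 2) d

  index-bound : ∀ i → 2 + toℕ i < n
  index-bound i = subst (2 + toℕ i <_) (m+[n∸m]≡n 2≤n) (+-monoʳ-< 2 (toℕ<n i))

  shift : ∀ i → t i ≡ apTerm n x d (2 + toℕ i)
  shift i = apTerm-shift {x = x} {d} 2 (toℕ i)

  cycle-index : ∀ i {u} → u < n → t i ≡ apTerm n x d u → 2 + toℕ i ≡ u
  cycle-index i u<n same =
    apTerm-injective {x = x} full (index-bound i) u<n (trans (sym (shift i)) same)

  t-injective : Injective _≡_ _≡_ t
  t-injective {i} {j} same = toℕ-injective (suc-injective (suc-injective
    (cycle-index i (index-bound j) (trans same (shift j)))))

  avoids : ∀ i u → u < 2 → t i ≢ apTerm n x d u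
  avoids i u u<2 same =
    <⇒≱ u<2 (subst (2 ≤_) (cycle-index i (<-≤-trans u<2 2≤n) same) (m≤m+n 2 (toℕ i)))

-- Injectivity away from a single point p: use x = p and d = 1.
rainbow-away-one : ∀ {n r} .{{_ : NonZero n}} {c : Fin n → Fin r} {p : Fin n} → 2 ≤ n →
  InjectiveAway c p p → HasRainbowAP n (n ∸ 2) c
rainbow-away-one {n} {p = p} 2≤n away = rainbow-away {x = p} {d = fromℕ< 2≤n} 2≤n
  (subst (FullOrder n) (sym (toℕ-fromℕ< 2≤n)) (fullOrder-one n))
  (away-one (apTerm-zero {x = p} {fromℕ< 2≤n}) away)

rainbow-away-ordered : ∀ {n r} .{{_ : NonZero n}} {c : Fin n → Fin r} {p q : Fin n} →
  Prime n → 2 ≤ n → toℕ p < toℕ q → InjectiveAway c p q → HasRainbowAP n (n ∸ 2) c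
rainbow-away-ordered {n} {c = c} {p} {q} n-prime 2≤n p<q away =
  rainbow-away {x = p} {d = d} 2≤n full
    (subst₂ (InjectiveAway c) (sym (apTerm-zero {x = p} {d})) (sym p+d≡q) away)
  where
  D<n : toℕ q ∸ toℕ p < n
  D<n = ≤-<-trans (m∸n≤m (toℕ q) (toℕ p)) (toℕ<n q)
  d : Fin n
  d = fromℕ< D<n
  full : FullOrder n (toℕ d)
  full = subst (FullOrder n) (sym (toℕ-fromℕ< D<n))
           (fullOrder-prime n-prime (m<n⇒0<n∸m p<q) D<n)
  d≡q-p : 1 * toℕ d ≡ toℕ q ∸ toℕ p
  d≡q-p = trans (*-identityˡ (toℕ d)) (toℕ-fromℕ< D<n)
  p+d≡q : apTerm n p d 1 ≡ q
  p+d≡q = toℕ-injective (begin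
    toℕ (apTerm n p d 1)             ≡⟨ toℕ-apTerm {x = p} {d} 1 ⟩
    (toℕ p + 1 * toℕ d) % n          ≡⟨ cong (λ t → (toℕ p + t) % n) d≡q-p ⟩
    (toℕ p + (toℕ q ∸ toℕ p)) % n    ≡⟨ cong (_% n) (m+[n∸m]≡n (<⇒≤ p<q)) ⟩
    toℕ q % n                        ≡⟨ m<n⇒m%n≡m (toℕ<n q) ⟩
    toℕ q                            ∎)
    where open ≡-Reasoning

rainbow-away-prime : ∀ {n r} .{{_ : NonZero n}} {c : Fin n → Fin r} {p q : Fin n} →
  Prime n → 2 ≤ n → p ≢ q → InjectiveAway c p q → HasRainbowAP n (n ∸ 2) c
rainbow-away-prime {p = p} {q} n-prime 2≤n p≢q away with <-cmp (toℕ p) (toℕ q)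
... | tri< p<q _ _ = rainbow-away-ordered n-prime 2≤n p<q away
... | tri≈ _ p≡q _ = ⊥-elim (p≢q (toℕ-injective p≡q))
... | tri> _ _ q<p = rainbow-away-ordered n-prime 2≤n q<p (away-sym away)

-- aw(ℤ_n, n-2) ≤ n-2 for prime n: at most two points are surplus.
prime-upper : ∀ {n} .{{_ : NonZero n}} → 2 ≤ n → Prime n →
  EveryExactColoringRainbow n (n ∸ 2) (n ∸ 2)
prime-upper {n} 2≤n n-prime c exact = by-cases (surplus-cases (toZ n 0))
  where
  open Surplus c exact
  by-cases : SurplusCases → HasRainbowAP n (n ∸ 2) c
  by-cases (inj₁ (p , away)) = rainbow-away-one 2≤n away
  by-cases (inj₂ (p , q , p≢q , sp , sq)) = rainbow-away-prime n-prime 2≤n p≢q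
    (two-surplus-away (≤-reflexive (sym (m∸n+n≡m 2≤n))) p≢q sp sq)

-- aw(ℤ_n, n-2) ≤ n-1 for every n ≥ 2: at most one point is surplus.
n-1-upper : ∀ {n} .{{_ : NonZero n}} → 2 ≤ n → EveryExactColoringRainbow n (n ∸ 2) (n ∸ 1)
n-1-upper {n} 2≤n c exact = by-cases (surplus-cases (toZ n 0))
  where
  open Surplus c exact
  by-cases : SurplusCases → HasRainbowAP n (n ∸ 2) c
  by-cases (inj₁ (p , away)) = rainbow-away-one 2≤n away
  by-cases (inj₂ (p , q , p≢q , sp , sq)) =
    ⊥-elim (no-two-surplus (≤-reflexive (sym (m∸n+n≡m (<⇒≤ 2≤n)))) p≢q sp sq)

rainbow⇒k≤r : ∀ {n k r} .{{_ : NonZero n}} {c : Fin n → Fin r} → HasRainbowAP n k c → k ≤ r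
rainbow⇒k≤r (_ , _ , _ , rainbow) = injective⇒≤ rainbow

-- Fewer than k colours: colouring by residues mod s is exact on ℤ_n (s ≤ n), and no k-AP
-- can be rainbow.
few-colours-fail : ∀ {n k s} .{{_ : NonZero n}} → 1 ≤ s → s < k → s ≤ n →
  ¬ EveryExactColoringRainbow n k s
few-colours-fail {n} {k} {s@(suc _)} _ s<k s≤n every =
  <⇒≱ s<k (rainbow⇒k≤r {c = residue} (every residue residue-exact))
  where
  residue : Fin n → Fin s
  residue z = toZ s (toℕ z)
  residue-exact : Surjective _≡_ _≡_ residue
  residue-exact y = fromℕ< y<n , λ { refl → toℕ-injective (begin
    toℕ (residue (fromℕ< y<n))  ≡⟨ toℕ-fromℕ< _ ⟩
    toℕ (fromℕ< y<n) % s        ≡⟨ cong (_% s) (toℕ-fromℕ< y<n) ⟩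
    toℕ y % s                   ≡⟨ m<n⇒m%n≡m (toℕ<n y) ⟩
    toℕ y                       ∎) }
    where
    open ≡-Reasoning
    y<n : toℕ y < n
    y<n = <-≤-trans (toℕ<n y) s≤n

-- merge i j : Fin (suc k) → Fin k sends j to the image of i and is otherwise injective
-- and onto.
merge : ∀ {k} (i j : Fin (suc k)) → i ≢ j → Fin (suc k) → Fin k
merge i j i≢j z with z Fin.≟ j
... | yes _ = punchOut {i = j} (≢-sym i≢j)
... | no z≢j = punchOut {i = j} (≢-sym z≢j)

merge-identifies : ∀ {k} {i j : Fin (suc k)} (i≢j : i ≢ j) → merge i j i≢j j ≡ merge i j i≢j i
merge-identifies {i = i} {j} i≢j with j Fin.≟ j | i Fin.≟ j
... | no j≢j | _ = ⊥-elim (j≢j refl)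
... | yes _ | yes i≡j = ⊥-elim (i≢j i≡j)
... | yes _ | no _ = punchOut-cong j refl

merge-injective : ∀ {k} {i j : Fin (suc k)} (i≢j : i ≢ j) {z w} → z ≢ j → w ≢ j →
  merge i j i≢j z ≡ merge i j i≢j w → z ≡ w
merge-injective {i = i} {j} i≢j {z} {w} z≢j w≢j same with z Fin.≟ j | w Fin.≟ j
... | yes z≡j | _ = ⊥-elim (z≢j z≡j)
... | no _ | yes w≡j = ⊥-elim (w≢j w≡j)
... | no z≢j′ | no w≢j′ = punchOut-injective (≢-sym z≢j′) (≢-sym w≢j′) same

merge-punchIn : ∀ {k} {i j : Fin (suc k)} (i≢j : i ≢ j) y → merge i j i≢j (punchIn j y) ≡ y
merge-punchIn {i = i} {j} i≢j y with punchIn j y Fin.≟ j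
... | yes hit = ⊥-elim (punchInᵢ≢i j y hit)
... | no _ = trans (punchOut-cong j refl) (punchOut-punchIn j)

monochromatic-triple : ∀ {k} {u v w : Fin (2 + k)} → u ≢ v → u ≢ w → v ≢ w →
  Σ[ c ∈ (Fin (2 + k) → Fin k) ] Surjective _≡_ _≡_ c × c u ≡ c v × c u ≡ c w
monochromatic-triple {k} {u} {v} {w} u≢v u≢w v≢w =
  c , exact , cong second (sym (merge-identifies u≢v)) , sym (merge-identifies u′≢w′)
  where
  first : Fin (2 + k) → Fin (suc k)
  first = merge u v u≢v
  u′≢w′ : first u ≢ first w
  u′≢w′ same = u≢w (merge-injective u≢v u≢v (≢-sym v≢w) same)
  second : Fin (suc k) → Fin k
  second = merge (first u) (first w) u′≢w′
  c : Fin (2 + k) → Fin k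
  c = second ∘ first
  exact : Surjective _≡_ _≡_ c
  exact y = punchIn v (punchIn (first w) y) , λ { refl →
    trans (cong second (merge-punchIn u≢v (punchIn (first w) y))) (merge-punchIn u′≢w′ y) }

-- Terms i < j of a cycle in ℤ_{k+2} with k ≤ i and j < k + 2 are consecutive, so a
-- proper divisor e of k + 2 does not divide both when the difference has full order.
tail-pair : ∀ {k e} {a d : Fin (2 + k)} → FullOrder (2 + k) (toℕ d) → e ∣ 2 + k → 2 ≤ e →
  ∀ {i j} → k ≤ i → i < j → j < 2 + k →
  e ∣ toℕ (apTerm (2 + k) a d i) → e ∣ toℕ (apTerm (2 + k) a d j) → ⊥
tail-pair {k} {e} {a} {d} full e∣n 2≤e {i} {j} k≤i i<j j<n e∣aᵢ e∣aⱼ =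
  fullOrder⇒∤ full e∣n 2≤e (consecutive-multiples {x = a} {d} {i} e∣n e∣aᵢ
    (subst (λ t → e ∣ toℕ (apTerm (2 + k) a d t)) j≡1+i e∣aⱼ))
  where
  j≡1+i : j ≡ suc i
  j≡1+i = ≤-antisym (≤-trans (s≤s⁻¹ j<n) (s≤s k≤i)) i<j

-- Two distinct points missed by a k-AP of full-order difference in ℤ_{k+2} are not
-- both multiples of a proper divisor e of k + 2: they are its two tail terms.
missed-pair : ∀ {k e} {a d : Fin (2 + k)} → FullOrder (2 + k) (toℕ d) → e ∣ 2 + k → 2 ≤ e →
  ∀ {α β} → α ≢ β → (∀ i → apSeq (2 + k) k a d i ≢ α) → (∀ i → apSeq (2 + k) k a d i ≢ β) →
  e ∣ toℕ α → e ∣ toℕ β → ⊥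
missed-pair {k} {e} {a} {d} full e∣n 2≤e {α} {β} α≢β α-missed β-missed e∣α e∣β
  with missed-tail {x = a} full α α-missed | missed-tail {x = a} full β β-missed
... | i , k≤i , i<n , refl | j , k≤j , j<n , refl with <-cmp i j
...   | tri< i<j _ _ = tail-pair {a = a} full e∣n 2≤e k≤i i<j j<n e∣α e∣β
...   | tri≈ _ refl _ = α≢β refl
...   | tri> _ _ j<i = tail-pair {a = a} full e∣n 2≤e k≤j j<i i<n e∣β e∣α

rainbow-meets-once : ∀ {n k r} {c : Fin n → Fin r} {t : Fin k → Fin n} →
  Injective _≡_ _≡_ (c ∘ t) → ∀ {x y} i j → t i ≡ x → t j ≡ y → c x ≡ c y → x ≡ y
rainbow-meets-once {t = t} rainbow i j refl refl same = cong t (rainbow same)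

-- Three distinct equally coloured multiples of a proper divisor e of k + 2 (k ≥ 3) rule
-- out a rainbow k-AP: its difference has full order, and it misses two of the three.
no-rainbow : ∀ {k r e} {c : Fin (2 + k) → Fin r} {u v w : Fin (2 + k)} →
  3 ≤ k → e ∣ 2 + k → 2 ≤ e → u ≢ v → u ≢ w → v ≢ w → c u ≡ c v → c u ≡ c w → e ∣ toℕ u → e ∣ toℕ v → e ∣ toℕ w →
  ¬ HasRainbowAP (2 + k) k c
no-rainbow {k} {e = e} {c = c} {u} {v} {w} 3≤k e∣n 2≤e u≢v u≢w v≢w cu≡cv cu≡cw e∣u e∣v e∣w
  (a , d , (_ , injective) , rainbow) =
  by-cases (any? (λ i → t i Fin.≟ u)) (any? (λ i → t i Fin.≟ v))
  where
  t : Fin k → Fin (2 + k)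
  t = apSeq (2 + k) k a d

  missed : ∀ {α β} → α ≢ β → (∀ i → t i ≢ α) → (∀ i → t i ≢ β) → e ∣ toℕ α → e ∣ toℕ β → ⊥
  missed = missed-pair {a = a} (injectiveAP⇒fullOrder {x = a} (+-monoˡ-≤ k 3≤k) injective) e∣n 2≤e

  once : ∀ {x y} i j → t i ≡ x → t j ≡ y → c x ≡ c y → x ≡ y
  once = rainbow-meets-once {c = c} {t} rainbow

  by-cases : Dec (∃ λ i → t i ≡ u) → Dec (∃ λ i → t i ≡ v) → ⊥
  by-cases (yes (i , tᵢ≡u)) _ = missed v≢w
    (λ j tⱼ≡v → u≢v (once i j tᵢ≡u tⱼ≡v cu≡cv))
    (λ j tⱼ≡w → u≢w (once i j tᵢ≡u tⱼ≡w cu≡cw)) e∣v e∣w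
  by-cases (no u-missed) (yes (i , tᵢ≡v)) = missed u≢w
    (λ j tⱼ≡u → u-missed (j , tⱼ≡u))
    (λ j tⱼ≡w → v≢w (once i j tᵢ≡v tⱼ≡w (trans (sym cu≡cv) cu≡cw))) e∣u e∣w
  by-cases (no u-missed) (no v-missed) = missed u≢v
    (λ j tⱼ≡u → u-missed (j , tⱼ≡u)) (λ j tⱼ≡v → v-missed (j , tⱼ≡v)) e∣u e∣v

multiples-colouring-fails : ∀ {k e} → 3 ≤ k → 2 ≤ e → e ∣ 2 + k → e + e < 2 + k →
  ¬ EveryExactColoringRainbow (2 + k) k k
multiples-colouring-fails {k} {e} 3≤k 2≤e e∣n 2e<n every =
  let c , exact , c0≡ce , c0≡c2e = monochromatic-triple 0≢e 0≢2e e≢2e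
  in no-rainbow {c = c} 3≤k e∣n 2≤e 0≢e 0≢2e e≢2e c0≡ce c0≡c2e
       (e ∣0) (subst (e ∣_) (sym (toℕ-fromℕ< e<n)) ∣-refl)
       (subst (e ∣_) (sym (toℕ-fromℕ< 2e<n)) (∣m∣n⇒∣m+n ∣-refl ∣-refl)) (every c exact)
  where
  e<n : e < 2 + k
  e<n = ≤-<-trans (m≤m+n e e) 2e<n
  0<e : 0 < e
  0<e = <-≤-trans z<s 2≤e
  0≢e : Fin.zero ≢ fromℕ< e<n
  0≢e same = <⇒≢ 0<e (trans (cong toℕ same) (toℕ-fromℕ< e<n))
  0≢2e : Fin.zero ≢ fromℕ< 2e<n
  0≢2e same = <⇒≢ (≤-trans 0<e (m≤m+n e e)) (trans (cong toℕ same) (toℕ-fromℕ< 2e<n))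
  e≢2e : fromℕ< e<n ≢ fromℕ< 2e<n
  e≢2e same = <⇒≢ (m<m+n e 0<e)
    (trans (sym (toℕ-fromℕ< e<n)) (trans (cong toℕ same) (toℕ-fromℕ< 2e<n)))

-- A composite n ≥ 5 has a divisor e ≥ 2 with 2e < n: a nontrivial divisor e₀ if n/e₀ ≥ 3,
-- and 2 if n = 2e₀.
small-divisor : ∀ {n e₀} → 5 ≤ n → 1 < e₀ → e₀ < n → e₀ ∣ n →
  ∃[ e ] 2 ≤ e × e ∣ n × e + e < n
small-divisor 5≤n 1<e₀ e₀<n (divides zero n≡0) =
  ⊥-elim (<⇒≱ (<-≤-trans z<s 5≤n) (≤-reflexive n≡0))
small-divisor {e₀ = e₀} 5≤n 1<e₀ e₀<n (divides 1 n≡e₀) =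
  ⊥-elim (<⇒≢ e₀<n (sym (trans n≡e₀ (+-identityʳ e₀))))
small-divisor {e₀ = e₀} 5≤n 1<e₀ e₀<n (divides 2 n≡2e₀) =
  2 , ≤-refl , divides e₀ (trans n≡2e₀ (*-comm 2 e₀)) , 5≤n
small-divisor {e₀ = e₀} 5≤n 1<e₀ e₀<n (divides (suc (suc (suc q))) n≡) =
  e₀ , 1<e₀ , divides (3 + q) n≡ ,
  subst (e₀ + e₀ <_) (sym n≡) (+-monoʳ-< e₀ (m<m+n e₀ (<-≤-trans 0<e₀ (m≤m+n e₀ (q * e₀)))))
  where
  0<e₀ : 0 < e₀
  0<e₀ = <-trans z<s 1<e₀

composite-lower : ∀ {k} → 3 ≤ k → ¬ Prime (2 + k) → ¬ EveryExactColoringRainbow (2 + k) k k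
composite-lower {k} 3≤k not-prime with ¬prime⇒composite not-prime
... | composite {e₀} e₀<n e₀∣n =
  let e , 2≤e , e∣n , 2e<n = small-divisor (s≤s (s≤s 3≤k)) (nonTrivial⇒n>1 e₀) e₀<n e₀∣n
  in multiples-colouring-fails 3≤k 2≤e e∣n 2e<n

proposition3p24 : (n : ℕ) → .{{_ : NonZero n}} → 5 ≤ n →
    (Prime n → AWEq n (n ∸ 2) (n ∸ 2)) × (¬ Prime n → AWEq n (n ∸ 2) (n ∸ 1))
proposition3p24 (suc zero) (s≤s ())
proposition3p24 (suc (suc k)) 5≤n = prime-case , composite-case
  where
  3≤k : 3 ≤ k
  3≤k = s≤s⁻¹ (s≤s⁻¹ 5≤n)
  2≤n : 2 ≤ 2 + k
  2≤n = s≤s (s≤s z≤n)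
  1≤k : 1 ≤ k
  1≤k = ≤-trans (s≤s z≤n) 3≤k

  fewer-fail : ∀ s → 1 ≤ s → s < k → ¬ EveryExactColoringRainbow (2 + k) k s
  fewer-fail s 1≤s s<k = few-colours-fail 1≤s s<k (≤-trans (<⇒≤ s<k) (m≤n+m k 2))

  prime-case : Prime (2 + k) → AWEq (2 + k) k k
  prime-case n-prime = 1≤k , prime-upper 2≤n n-prime , fewer-fail

  composite-case : ¬ Prime (2 + k) → AWEq (2 + k) k (suc k)
  composite-case not-prime = s≤s z≤n , n-1-upper 2≤n , below
    where
    below : ∀ s → 1 ≤ s → s < suc k → ¬ EveryExactColoringRainbow (2 + k) k s
    below s 1≤s s<1+k with m≤n⇒m<n∨m≡n (s≤s⁻¹ s<1+k)
    ... | inj₁ s<k = fewer-fail s 1≤s s<k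
    ... | inj₂ refl = composite-lower 3≤k not-prime
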